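{- Let $\vdash$ be a deductive relation on a dually integral Abelian pomonoid $\mathbf{R}=\langle R,\leq,+,0\rangle$. For $x\in R$ let $\mathrm{Th}_\vdash(x)=\{y\in R:x\vdash y\}$, and let $\mathrm{Th}^p(\vdash)=\{\mathrm{Th}_\vdash(x):x\in R\}$. Define $\mathrm{Th}_\vdash(x)+^\vdash\mathrm{Th}_\vdash(y)=\mathrm{Th}_\vdash(x+y)$. Then $+^\vdash$ is well defined, $\langle\mathrm{Th}^p(\vdash),\subseteq,+^\vdash,\mathrm{Th}_\vdash(0)\rangle$ is a dually integral pomonoid, and the map $\mathrm{Th}_\vdash\colon R\to\mathrm{Th}^p(\vdash)$ is a surjective morphism (order-preserving monoid homomorphism).
   Context: A dually integral Abelian pomonoid is $\langle R,\leq,+,0\rangle$ where $\langle R,+,0\rangle$ is a commutative monoid, $\leq$ is a partial order with $a\leq b\Rightarrow a+c\leq b+c$, and $0$ is the least element. A deductive relation on it is a relation $\vdash$ on $R$ such that: $a\leq b$ implies $b\vdash a$; $a\vdash b$ and $b\vdash c$ imply $a\vdash c$; $a\vdash b$ implies $a+c\vdash b+c$. A dually integral pomonoid means a monoid with a compatible partial order whose unit is the least element. -}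

module Defs where

open import Level using (0ℓ)
open import Algebra.Core using (Op₂)
open import Algebra.Structures using (IsMonoid; IsCommutativeMonoid)
open import Relation.Binary.Core using (Rel)
open import Relation.Binary.Structures using (IsPartialOrder)
open import Relation.Binary.PropositionalEquality using (_≡_)
open import Data.Product using (Σ; ∃; _×_; _,_; proj₁)

-- A (not necessarily commutative) pomonoid ⟨A, ≤, ∙, ε⟩ w.r.t. an equality ≈,
-- whose unit ε is the least element (dually integral).
record IsDIPomonoid {A : Set₁} (_≈_ : Rel A 0ℓ) (_≤_ : Rel A 0ℓ)
                    (_∙_ : Op₂ A) (ε : A) : Set₁ where
  field
    isMonoid       : IsMonoid _≈_ _∙_ ε
    isPartialOrder : IsPartialOrder _≈_ _≤_
    monoˡ          : ∀ {a b} c → a ≤ b → (a ∙ c) ≤ (b ∙ c)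
    monoʳ          : ∀ {a b} c → a ≤ b → (c ∙ a) ≤ (c ∙ b)
    least          : ∀ a → ε ≤ a

record IsDIAbelianPomonoid {R : Set} (_≤_ : Rel R 0ℓ) (_+_ : Op₂ R) (ε : R) : Set where
  field
    isCommutativeMonoid : IsCommutativeMonoid _≡_ _+_ ε
    isPartialOrder      : IsPartialOrder _≡_ _≤_
    mono                : ∀ {a b} c → a ≤ b → (a + c) ≤ (b + c)
    least               : ∀ a → ε ≤ a

record IsDeductive {R : Set} (_≤_ : Rel R 0ℓ) (_+_ : Op₂ R) (_⊢_ : Rel R 0ℓ) : Set where
  field
    ≤⇒⊢   : ∀ {a b} → a ≤ b → b ⊢ a
    trans : ∀ {a b c} → a ⊢ b → b ⊢ c → a ⊢ c
    cong+ : ∀ {a b} c → a ⊢ b → (a + c) ⊢ (b + c)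

module Subsets {R : Set} where
  Pred : Set₁
  Pred = R → Set

  _⊆_ : Rel Pred 0ℓ
  P ⊆ Q = ∀ z → P z → Q z

  _≐_ : Rel Pred 0ℓ
  P ≐ Q = (P ⊆ Q) × (Q ⊆ P)

module Theories {R : Set} (_+_ : Op₂ R) (ε : R) (_⊢_ : Rel R 0ℓ) where
  open Subsets {R}

  Th : R → Pred
  Th x y = x ⊢ y

  -- Thᵖ(⊢) = { Th⊢(x) : x ∈ R }, a subset T of R together with a witness x, T = Th⊢(x)
  ThP : Set₁
  ThP = Σ Pred λ T → ∃ λ x → T ≐ Th x

  th : R → ThP
  th x = Th x , x , ((λ _ p → p) , (λ _ p → p))

  _≐ᵗ_ : Rel ThP 0ℓ
  S ≐ᵗ T = proj₁ S ≐ proj₁ T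

  _⊆ᵗ_ : Rel ThP 0ℓ
  S ⊆ᵗ T = proj₁ S ⊆ proj₁ T

  _+ᵗ_ : Op₂ ThP
  (_ , x , _) +ᵗ (_ , y , _) = th (x + y)

  -- well-definedness: the result does not depend on the choice of representatives
  WellDefined : Set
  WellDefined = ∀ x x′ y y′ → Th x ≐ Th x′ → Th y ≐ Th y′ → Th (x + y) ≐ Th (x′ + y′)

-- Th x ⊆ Th x′ holds exactly when x′ ⊢ x, so Thᵖ(⊢) is R ordered by the
-- converse of ⊢ and quotiented by mutual derivability.  Since ⊢ is compatible
-- with + on both sides (by commutativity), x ⊢ x′ and y ⊢ y′ give
-- x + y ⊢ x′ + y′; this yields well-definedness and monotonicity of +⊢ at once,
-- and the monoid laws and leastness of Th(0) are inherited from R.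
module Submission where

open import Defs
open import Level using (0ℓ)
open import Algebra.Core using (Op₂)
open import Algebra.Structures using (IsMonoid; IsCommutativeMonoid)
open import Relation.Binary.Core using (Rel)
open import Relation.Binary.Structures using (IsEquivalence; IsPartialOrder)
open import Relation.Binary.PropositionalEquality using (_≡_; refl; subst₂)
import Relation.Binary.Construct.On as On
open import Data.Product using (∃; _×_; _,_; proj₁; proj₂)

module SubsetProperties {R : Set} where
  open Subsets {R}

  ⊆-refl : ∀ {P} → P ⊆ P
  ⊆-refl _ p = p

  ⊆-trans : ∀ {P Q S} → P ⊆ Q → Q ⊆ S → P ⊆ S
  ⊆-trans f g z p = g z (f z p)

  ≐-isEquivalence : IsEquivalence _≐_
  ≐-isEquivalence = record
    { refl  = ⊆-refl , ⊆-refl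
    ; sym   = λ (f , g) → g , f
    ; trans = λ (f , f′) (g , g′) → ⊆-trans f g , ⊆-trans g′ f′
    }

  ⊆-isPartialOrder : IsPartialOrder _≐_ _⊆_
  ⊆-isPartialOrder = record
    { isPreorder = record
      { isEquivalence = ≐-isEquivalence
      ; reflexive     = proj₁
      ; trans         = ⊆-trans
      }
    ; antisym = _,_
    }

module TheoryPomonoid {R : Set} {_≤_ : Rel R 0ℓ} {_+_ : Op₂ R} {ε : R} {_⊢_ : Rel R 0ℓ}
  (pomonoid : IsDIAbelianPomonoid _≤_ _+_ ε) (deductive : IsDeductive _≤_ _+_ _⊢_) where

  open Subsets {R}
  open SubsetProperties {R}
  open Theories _+_ ε _⊢_
  open IsDIAbelianPomonoid pomonoid
  open IsCommutativeMonoid isCommutativeMonoid using (comm; assoc; identityˡ; identityʳ)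
  open IsDeductive deductive renaming (trans to ⊢-trans)
  module ≐ = IsEquivalence ≐-isEquivalence

  ⊢-refl : ∀ {a} → a ⊢ a
  ⊢-refl = ≤⇒⊢ (IsPartialOrder.refl isPartialOrder)

  ⊢⇒Th-⊆ : ∀ {x x′} → x′ ⊢ x → Th x ⊆ Th x′
  ⊢⇒Th-⊆ x′⊢x _ = ⊢-trans x′⊢x

  Th-⊆⇒⊢ : ∀ {x x′} → Th x ⊆ Th x′ → x′ ⊢ x
  Th-⊆⇒⊢ Thx⊆Thx′ = Thx⊆Thx′ _ ⊢-refl

  Th-resp-≡ : ∀ {x y} → x ≡ y → Th x ≐ Th y
  Th-resp-≡ refl = ≐.refl

  cong+ˡ : ∀ {a b} c → a ⊢ b → (c + a) ⊢ (c + b)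
  cong+ˡ {a} {b} c a⊢b = subst₂ _⊢_ (comm a c) (comm b c) (cong+ c a⊢b)

  +-cong-⊢ : ∀ {a a′ b b′} → a ⊢ a′ → b ⊢ b′ → (a + b) ⊢ (a′ + b′)
  +-cong-⊢ {a′ = a′} {b = b} a⊢a′ b⊢b′ = ⊢-trans (cong+ b a⊢a′) (cong+ˡ a′ b⊢b′)

  Th-+-mono : ∀ {x x′ y y′} → Th x ⊆ Th x′ → Th y ⊆ Th y′ → Th (x + y) ⊆ Th (x′ + y′)
  Th-+-mono x⊆x′ y⊆y′ = ⊢⇒Th-⊆ (+-cong-⊢ (Th-⊆⇒⊢ x⊆x′) (Th-⊆⇒⊢ y⊆y′))

  wellDefined : WellDefined
  wellDefined _ _ _ _ (x⊆x′ , x′⊆x) (y⊆y′ , y′⊆y) = Th-+-mono x⊆x′ y⊆y′ , Th-+-mono x′⊆x y′⊆y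

  -- By η for Σ, S +ᵗ T reduces to th (rep S + rep T) for arbitrary S and T.
  rep : ThP → R
  rep T = proj₁ (proj₂ T)

  rep-spec : ∀ T → proj₁ T ≐ Th (rep T)
  rep-spec T = proj₂ (proj₂ T)

  ⊆ᵗ⇒Th-rep-⊆ : ∀ {S T} → S ⊆ᵗ T → Th (rep S) ⊆ Th (rep T)
  ⊆ᵗ⇒Th-rep-⊆ {S} {T} S⊆T = ⊆-trans (proj₂ (rep-spec S)) (⊆-trans S⊆T (proj₁ (rep-spec T)))

  +ᵗ-mono : ∀ {S S′ T T′} → S ⊆ᵗ S′ → T ⊆ᵗ T′ → (S +ᵗ T) ⊆ᵗ (S′ +ᵗ T′)
  +ᵗ-mono {S} {S′} {T} {T′} S⊆S′ T⊆T′ =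
    Th-+-mono (⊆ᵗ⇒Th-rep-⊆ {S} {S′} S⊆S′) (⊆ᵗ⇒Th-rep-⊆ {T} {T′} T⊆T′)

  +ᵗ-cong : ∀ {S S′ T T′} → S ≐ᵗ S′ → T ≐ᵗ T′ → (S +ᵗ T) ≐ᵗ (S′ +ᵗ T′)
  +ᵗ-cong {S} {S′} {T} {T′} (S⊆S′ , S′⊆S) (T⊆T′ , T′⊆T) =
    +ᵗ-mono {S} {S′} {T} {T′} S⊆S′ T⊆T′ , +ᵗ-mono {S′} {S} {T′} {T} S′⊆S T′⊆T

  +ᵗ-isMonoid : IsMonoid _≐ᵗ_ _+ᵗ_ (th ε)
  +ᵗ-isMonoid = record
    { isSemigroup = record
      { isMagma = record
        { isEquivalence = On.isEquivalence proj₁ ≐-isEquivalence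
        ; ∙-cong        = λ {S} {S′} {T} {T′} → +ᵗ-cong {S} {S′} {T} {T′}
        }
      ; assoc = λ S T U → Th-resp-≡ (assoc (rep S) (rep T) (rep U))
      }
    ; identity = (λ S → ≐.trans (Th-resp-≡ (identityˡ (rep S))) (≐.sym (rep-spec S)))
               , (λ S → ≐.trans (Th-resp-≡ (identityʳ (rep S))) (≐.sym (rep-spec S)))
    }

  theories-isDIPomonoid : IsDIPomonoid _≐ᵗ_ _⊆ᵗ_ _+ᵗ_ (th ε)
  theories-isDIPomonoid = record
    { isMonoid       = +ᵗ-isMonoid
    ; isPartialOrder = On.isPartialOrder proj₁ ⊆-isPartialOrder
    ; monoˡ          = λ {S} {S′} U S⊆S′ → +ᵗ-mono {S} {S′} {U} {U} S⊆S′ ⊆-refl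
    ; monoʳ          = λ {S} {S′} U S⊆S′ → +ᵗ-mono {U} {U} {S} {S′} ⊆-refl S⊆S′
    ; least          = λ S → ⊆-trans (⊢⇒Th-⊆ (≤⇒⊢ (least (rep S)))) (proj₂ (rep-spec S))
    }

  th-surjective : ∀ T → ∃ λ x → th x ≐ᵗ T
  th-surjective T = rep T , ≐.sym (rep-spec T)

theorem3p13 : {R : Set} (_≤_ : Rel R 0ℓ) (_+_ : Op₂ R) (ε : R) (_⊢_ : Rel R 0ℓ) →
    IsDIAbelianPomonoid _≤_ _+_ ε → IsDeductive _≤_ _+_ _⊢_ →
    let open Theories _+_ ε _⊢_ in
    WellDefined
    × IsDIPomonoid _≐ᵗ_ _⊆ᵗ_ _+ᵗ_ (th ε)
    × (∀ {x y} → x ≤ y → th x ⊆ᵗ th y)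
    × (∀ x y → th (x + y) ≐ᵗ (th x +ᵗ th y))
    × (th ε ≐ᵗ th ε)
    × (∀ (T : ThP) → ∃ λ x → th x ≐ᵗ T)
theorem3p13 _ _ _ _ pomonoid deductive =
    wellDefined
  , theories-isDIPomonoid
  , (λ x≤y → ⊢⇒Th-⊆ (≤⇒⊢ x≤y))
  , (λ _ _ → ≐.refl)
  , ≐.refl
  , th-surjective
  where
  open TheoryPomonoid pomonoid deductive
  open IsDeductive deductive using (≤⇒⊢)
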